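{- Let $t\in\mathbb{Z}$ and $$f_1(x)=x^4+2x^3+(2t^2+2)x^2+(4t^2-4t+2)x+6t^2-4t+1.$$ If $t\notin\{0,1\}$, then $f_1$ is irreducible over $\mathbb{Q}$. -}

module Defs where

open import Data.Integer as ℤ using (ℤ; +_)
open import Data.Rational as ℚ using (ℚ; 0ℚ; 1ℚ; _/_)
open import Data.List using (List; []; _∷_; map)
open import Data.Nat using (ℕ; zero; suc)
open import Data.Product using (Σ; _×_)
open import Data.Sum using (_⊎_)
open import Relation.Binary.PropositionalEquality using (_≡_)
open import Relation.Nullary using (¬_)

-- Polynomials over ℚ, as lists of coefficients, lowest degree first.
-- Trailing zeros are allowed; polynomial equality is coefficientwise (_≈ₚ_).
Poly : Set
Poly = List ℚ

coeff : Poly → ℕ → ℚ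
coeff []       _       = 0ℚ
coeff (a ∷ p)  zero    = a
coeff (a ∷ p)  (suc n) = coeff p n

_≈ₚ_ : Poly → Poly → Set
p ≈ₚ q = ∀ n → coeff p n ≡ coeff q n

infixl 6 _+ₚ_
infixl 7 _*ₚ_
infix 4 _≈ₚ_

_+ₚ_ : Poly → Poly → Poly
[]      +ₚ q       = q
(a ∷ p) +ₚ []      = a ∷ p
(a ∷ p) +ₚ (b ∷ q) = (a ℚ.+ b) ∷ (p +ₚ q)

_*ₚ_ : Poly → Poly → Poly
[]      *ₚ q = []
(a ∷ p) *ₚ q = map (a ℚ.*_) q +ₚ (0ℚ ∷ (p *ₚ q))

0ₚ : Poly
0ₚ = []

1ₚ : Poly
1ₚ = 1ℚ ∷ []

IsUnit : Poly → Set
IsUnit p = Σ Poly λ q → p *ₚ q ≈ₚ 1ₚ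

Irreducible : Poly → Set
Irreducible f = ¬ (f ≈ₚ 0ₚ) × ¬ IsUnit f
              × (∀ g h → f ≈ₚ g *ₚ h → IsUnit g ⊎ IsUnit h)

ℤ→ℚ : ℤ → ℚ
ℤ→ℚ z = z / 1

f₁ : ℤ → Poly
f₁ t = map ℤ→ℚ
  ( (+ 6 ℤ.* t ℤ.* t ℤ.- + 4 ℤ.* t ℤ.+ + 1)
  ∷ (+ 4 ℤ.* t ℤ.* t ℤ.- + 4 ℤ.* t ℤ.+ + 2)
  ∷ (+ 2 ℤ.* t ℤ.* t ℤ.+ + 2)
  ∷ + 2
  ∷ + 1
  ∷ [] )

module Submission where

-- f₁ is monic of degree 4, so in a factorisation f₁ = g·h the degrees add up to
-- 4, and a factor of degree 0 is a unit.  The other splittings are excluded by: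
--   (1) f₁(r) = ((r+1)r)² + (r+1−2t)² + 2(t(r+1))² vanishes only if t = 0, so
--       f₁ has no rational root and no linear factor;
--   (2) if f₁ = (x²+ax+b)(x²+cx+d), eliminating b, c, d makes u = (a−1)² a root
--       of (u + 2t²−4t+1)(u² + (2t²+4t)u − (2t²−4t+1)); so 1 − 2(t−1)² or
--       D(t) = (t+1)⁴ − 8t = (u+t²+2t)² is a rational, hence an integer, square.
--       The first forces t = 1; D(t) lies strictly between consecutive squares.

open import Defs
open import Data.Integer using (ℤ; +_)
open import Relation.Binary.PropositionalEquality using (_≢_)

import Data.Integer as Z
import Data.Integer.Properties as ZP
import Data.Integer.Tactic.RingSolver as ZSolver
open import Data.Integer using (-[1+_]; +[1+_])
open import Data.Rational as Q using (ℚ; mkℚ; 0ℚ; 1ℚ; _+_; _*_; _-_; -_; 1/_)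
open import Data.Rational.Literals using (fromℤ)
import Data.Rational.Properties as QP
import Data.Rational.Unnormalised as U
import Data.Rational.Unnormalised.Properties as UP
open import Data.Nat as N using (ℕ; zero; suc; z≤n; s≤s)
import Data.Nat.Properties as NP
import Data.Nat.Tactic.RingSolver as NSolver
open import Data.Nat.Coprimality as Coprimality using (Coprime; 1-coprimeTo)
open import Data.Nat.Divisibility using (divides; ∣-refl) renaming (_∣_ to _∣ₙ_)
open import Data.List using ([]; _∷_; map)
open import Data.Product using (_×_; _,_; proj₁; proj₂; ∃)
open import Data.Sum using (_⊎_; inj₁; inj₂; [_,_]′)
open import Data.Empty using (⊥; ⊥-elim)
open import Data.Unit using (tt)
open import Function using (_∘_)
open import Relation.Nullary using (¬_; yes; no; contradiction)
open import Relation.Binary.Definitions using (tri<; tri≈; tri>)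
open import Relation.Binary.PropositionalEquality
  using (_≡_; refl; sym; trans; cong; cong₂; subst; subst₂; module ≡-Reasoning)
open import Tactic.RingSolver using (solve-∀)
open import Tactic.RingSolver.Core.AlmostCommutativeRing using (AlmostCommutativeRing; fromCommutativeRing)
import Relation.Nullary.Decidable.Core as Decidable

ℚ-ring : AlmostCommutativeRing _ _
ℚ-ring = fromCommutativeRing QP.+-*-commutativeRing (λ x → Decidable.dec⇒maybe (0ℚ QP.≟ x))

-- ℤ→ℚ z = z/1 is the unnormalised fraction fromℤ z; on such fractions the
-- ring operations of ℚ compute, which gives the morphism laws.
ℤ→ℚ≡fromℤ : ∀ z → ℤ→ℚ z ≡ fromℤ z
ℤ→ℚ≡fromℤ (+ n)    = QP.normalize-coprime (Coprimality.sym (1-coprimeTo n))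
ℤ→ℚ≡fromℤ -[1+ n ] = cong -_ (QP.normalize-coprime (Coprimality.sym (1-coprimeTo (suc n))))

ℤ→ℚ-+ : ∀ a b → ℤ→ℚ (a Z.+ b) ≡ ℤ→ℚ a + ℤ→ℚ b
ℤ→ℚ-+ a b = sym (trans (cong₂ _+_ (ℤ→ℚ≡fromℤ a) (ℤ→ℚ≡fromℤ b))
                       (cong ℤ→ℚ (cong₂ Z._+_ (ZP.*-identityʳ a) (ZP.*-identityʳ b))))

ℤ→ℚ-* : ∀ a b → ℤ→ℚ (a Z.* b) ≡ ℤ→ℚ a * ℤ→ℚ b
ℤ→ℚ-* a b = sym (cong₂ _*_ (ℤ→ℚ≡fromℤ a) (ℤ→ℚ≡fromℤ b))

ℤ→ℚ-neg : ∀ a → ℤ→ℚ (Z.- a) ≡ - ℤ→ℚ a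
ℤ→ℚ-neg a = trans (ℤ→ℚ≡fromℤ (Z.- a)) (trans (fromℤ-neg a) (cong -_ (sym (ℤ→ℚ≡fromℤ a))))
  where
  fromℤ-neg : ∀ z → fromℤ (Z.- z) ≡ - fromℤ z
  fromℤ-neg (+ zero)  = refl
  fromℤ-neg +[1+ n ]  = refl
  fromℤ-neg -[1+ n ]  = refl

ℤ→ℚ-- : ∀ a b → ℤ→ℚ (a Z.- b) ≡ ℤ→ℚ a - ℤ→ℚ b
ℤ→ℚ-- a b = trans (ℤ→ℚ-+ a (Z.- b)) (cong (λ x → ℤ→ℚ a + x) (ℤ→ℚ-neg b))

ℤ→ℚ-injective : ∀ a b → ℤ→ℚ a ≡ ℤ→ℚ b → a ≡ b
ℤ→ℚ-injective a b e = cong Q.↥_ (trans (sym (ℤ→ℚ≡fromℤ a)) (trans e (ℤ→ℚ≡fromℤ b)))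

-- natural-number constants in ℚ (the ring solver treats them as constants)
κ : ℕ → ℚ
κ n = ℤ→ℚ (+ n)

zero-divisor : ∀ x y → x * y ≡ 0ℚ → x ≡ 0ℚ ⊎ y ≡ 0ℚ
zero-divisor x y xy≡0 with x QP.≟ 0ℚ
... | yes x≡0 = inj₁ x≡0
... | no  x≢0 = inj₂ (begin
    y                ≡⟨ sym (QP.*-identityˡ y) ⟩
    1ℚ * y           ≡⟨ cong (_* y) (sym (QP.*-inverseˡ x)) ⟩
    (1/ x) * x * y   ≡⟨ QP.*-assoc (1/ x) x y ⟩
    (1/ x) * (x * y) ≡⟨ cong ((1/ x) *_) xy≡0 ⟩
    (1/ x) * 0ℚ      ≡⟨ QP.*-zeroʳ (1/ x) ⟩
    0ℚ               ∎)
  where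
  open ≡-Reasoning
  instance
    x-nonZero : Q.NonZero x
    x-nonZero = Q.≢-nonZero x≢0

square-zero : ∀ x → x * x ≡ 0ℚ → x ≡ 0ℚ
square-zero x xx≡0 = [ (λ e → e) , (λ e → e) ]′ (zero-divisor x x xx≡0)

square-nonneg : ∀ x → 0ℚ Q.≤ x * x
square-nonneg x@(mkℚ (+ n) _ _)    = QP.nonNegative⁻¹ _ {{QP.nonNeg*nonNeg⇒nonNeg x x}}
square-nonneg x@(mkℚ -[1+ n ] _ _) = QP.nonNegative⁻¹ _ {{QP.nonPos*nonPos⇒nonPos x x}}

nonneg-+ : ∀ {a b} → 0ℚ Q.≤ a → 0ℚ Q.≤ b → 0ℚ Q.≤ a + b
nonneg-+ {a} {b} a≥0 b≥0 = subst (Q._≤ a + b) (QP.+-identityʳ 0ℚ) (QP.+-mono-≤ a≥0 b≥0)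

nonneg-sum-zero : ∀ {a b} → 0ℚ Q.≤ a → 0ℚ Q.≤ b → a + b ≡ 0ℚ → a ≡ 0ℚ × b ≡ 0ℚ
nonneg-sum-zero {a} {b} a≥0 b≥0 a+b≡0 = QP.≤-antisym a≤0 a≥0 , QP.≤-antisym b≤0 b≥0
  where
  a≤0 : a Q.≤ 0ℚ
  a≤0 = subst₂ Q._≤_ (QP.+-identityʳ a) a+b≡0 (QP.+-monoʳ-≤ a b≥0)
  b≤0 : b Q.≤ 0ℚ
  b≤0 = subst₂ Q._≤_ (QP.+-identityˡ b) a+b≡0 (QP.+-monoˡ-≤ b a≥0)

≈ₚ-sym : ∀ p q → p ≈ₚ q → q ≈ₚ p
≈ₚ-sym p q p≈q n = sym (p≈q n)

≈ₚ-trans : ∀ p q r → p ≈ₚ q → q ≈ₚ r → p ≈ₚ r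
≈ₚ-trans p q r p≈q q≈r n = trans (p≈q n) (q≈r n)

coeff-+ : ∀ p q n → coeff (p +ₚ q) n ≡ coeff p n + coeff q n
coeff-+ []      q       n       = sym (QP.+-identityˡ _)
coeff-+ (a ∷ p) []      n       = sym (QP.+-identityʳ _)
coeff-+ (a ∷ p) (b ∷ q) zero    = refl
coeff-+ (a ∷ p) (b ∷ q) (suc n) = coeff-+ p q n

coeff-scale : ∀ a q n → coeff (map (a *_) q) n ≡ a * coeff q n
coeff-scale a []      n       = sym (QP.*-zeroʳ a)
coeff-scale a (b ∷ q) zero    = refl
coeff-scale a (b ∷ q) (suc n) = coeff-scale a q n

-- Cauchy product of coefficient sequences: convolve c d k = Σ_{i ≤ k} c i · d (k − i)
convolve : (ℕ → ℚ) → (ℕ → ℚ) → ℕ → ℚ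
convolve c d zero    = c 0 * d 0
convolve c d (suc k) = c 0 * d (suc k) + convolve (c ∘ suc) d k

convolve-zeroˡ : ∀ c d → (∀ i → c i ≡ 0ℚ) → ∀ k → convolve c d k ≡ 0ℚ
convolve-zeroˡ c d c≡0 zero    = trans (cong (_* d 0) (c≡0 0)) (QP.*-zeroˡ (d 0))
convolve-zeroˡ c d c≡0 (suc k) =
  trans (cong₂ _+_ (trans (cong (_* d (suc k)) (c≡0 0)) (QP.*-zeroˡ (d (suc k))))
                   (convolve-zeroˡ (c ∘ suc) d (c≡0 ∘ suc) k))
        (QP.+-identityˡ 0ℚ)

convolve-zeroʳ : ∀ c d → (∀ i → d i ≡ 0ℚ) → ∀ k → convolve c d k ≡ 0ℚ
convolve-zeroʳ c d d≡0 zero    = trans (cong (c 0 *_) (d≡0 0)) (QP.*-zeroʳ (c 0))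
convolve-zeroʳ c d d≡0 (suc k) =
  trans (cong₂ _+_ (trans (cong (c 0 *_) (d≡0 (suc k))) (QP.*-zeroʳ (c 0)))
                   (convolve-zeroʳ (c ∘ suc) d d≡0 k))
        (QP.+-identityˡ 0ℚ)

convolve-cong : ∀ {c c′ d d′} → (∀ i → c i ≡ c′ i) → (∀ i → d i ≡ d′ i) →
                ∀ k → convolve c d k ≡ convolve c′ d′ k
convolve-cong c≡ d≡ zero    = cong₂ _*_ (c≡ 0) (d≡ 0)
convolve-cong c≡ d≡ (suc k) = cong₂ _+_ (cong₂ _*_ (c≡ 0) (d≡ (suc k))) (convolve-cong (c≡ ∘ suc) d≡ k)

coeff-* : ∀ p q n → coeff (p *ₚ q) n ≡ convolve (coeff p) (coeff q) n
coeff-* []      q n       = sym (convolve-zeroˡ (coeff []) (coeff q) (λ _ → refl) n)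
coeff-* (a ∷ p) q zero    =
  trans (coeff-+ (map (a *_) q) (0ℚ ∷ (p *ₚ q)) 0)
        (trans (cong (_+ 0ℚ) (coeff-scale a q 0)) (QP.+-identityʳ _))
coeff-* (a ∷ p) q (suc n) =
  trans (coeff-+ (map (a *_) q) (0ℚ ∷ (p *ₚ q)) (suc n))
        (cong₂ _+_ (coeff-scale a q (suc n)) (coeff-* p q n))

*ₚ-cong : ∀ p p′ q q′ → p ≈ₚ p′ → q ≈ₚ q′ → p *ₚ q ≈ₚ p′ *ₚ q′
*ₚ-cong p p′ q q′ p≈ q≈ n =
  trans (coeff-* p q n) (trans (convolve-cong p≈ q≈ n) (sym (coeff-* p′ q′ n)))

*ₚ-zeroˡ : ∀ p q → p ≈ₚ 0ₚ → p *ₚ q ≈ₚ 0ₚ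
*ₚ-zeroˡ p q p≈0 n = trans (coeff-* p q n) (convolve-zeroˡ (coeff p) (coeff q) p≈0 n)

*ₚ-zeroʳ : ∀ p q → q ≈ₚ 0ₚ → p *ₚ q ≈ₚ 0ₚ
*ₚ-zeroʳ p q q≈0 n = trans (coeff-* p q n) (convolve-zeroʳ (coeff p) (coeff q) q≈0 n)

VanishesBeyond : (ℕ → ℚ) → ℕ → Set
VanishesBeyond c m = ∀ i → m N.< i → c i ≡ 0ℚ

HasDegree : Poly → ℕ → Set
HasDegree p m = (coeff p m ≢ 0ℚ) × VanishesBeyond (coeff p) m

degree : ∀ p → (p ≈ₚ 0ₚ) ⊎ ∃ (HasDegree p)
degree [] = inj₁ (λ _ → refl)
degree (a ∷ p) with degree p
... | inj₂ (m , p[m]≢0 , p-vanishes) =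
  inj₂ (suc m , p[m]≢0 , λ { (suc i) (s≤s m<i) → p-vanishes i m<i })
... | inj₁ p≈0 with a QP.≟ 0ℚ
...   | yes a≡0 = inj₁ (λ { zero → a≡0 ; (suc n) → p≈0 n })
...   | no  a≢0 = inj₂ (0 , a≢0 , λ { (suc i) _ → p≈0 i })

degree-cong : ∀ p q {m} → p ≈ₚ q → HasDegree p m → HasDegree q m
degree-cong p q {m} p≈q (p[m]≢0 , p-vanishes) =
  (λ q[m]≡0 → p[m]≢0 (trans (p≈q m) q[m]≡0)) , (λ i m<i → trans (sym (p≈q i)) (p-vanishes i m<i))

degree-unique : ∀ p {m n} → HasDegree p m → HasDegree p n → m ≡ n
degree-unique p {m} {n} (p[m]≢0 , p-vanishes-m) (p[n]≢0 , p-vanishes-n) with NP.<-cmp m n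
... | tri< m<n _ _ = contradiction (p-vanishes-m n m<n) p[n]≢0
... | tri≈ _ m≡n _ = m≡n
... | tri> _ _ n<m = contradiction (p-vanishes-n m n<m) p[m]≢0

convolve-const : ∀ c d → VanishesBeyond c 0 → ∀ k → convolve c d k ≡ c 0 * d k
convolve-const c d c-vanishes zero    = refl
convolve-const c d c-vanishes (suc k) =
  trans (cong (λ x → c 0 * d (suc k) + x) (convolve-zeroˡ (c ∘ suc) d (λ i → c-vanishes (suc i) (s≤s z≤n)) k))
        (QP.+-identityʳ _)

convolve-top : ∀ m c d n → VanishesBeyond c m → VanishesBeyond d n →
               convolve c d (m N.+ n) ≡ c m * d n
convolve-top zero    c d n c-vanishes d-vanishes = convolve-const c d c-vanishes n
convolve-top (suc m) c d n c-vanishes d-vanishes =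
  trans (cong₂ _+_ (trans (cong (c 0 *_) (d-vanishes (suc (m N.+ n)) (s≤s (NP.m≤n+m n m))))
                          (QP.*-zeroʳ (c 0)))
                   (convolve-top m (c ∘ suc) d n (λ i m<i → c-vanishes (suc i) (s≤s m<i)) d-vanishes))
        (QP.+-identityˡ _)

convolve-vanishes : ∀ m c d n → VanishesBeyond c m → VanishesBeyond d n →
                    VanishesBeyond (convolve c d) (m N.+ n)
convolve-vanishes zero c d n c-vanishes d-vanishes k n<k =
  trans (convolve-const c d c-vanishes k) (trans (cong (c 0 *_) (d-vanishes k n<k)) (QP.*-zeroʳ (c 0)))
convolve-vanishes (suc m) c d n c-vanishes d-vanishes (suc k) (s≤s m+n<k) =
  trans (cong₂ _+_ (trans (cong (c 0 *_) (d-vanishes (suc k) (s≤s (NP.≤-trans (NP.m≤n+m n m) (NP.<⇒≤ m+n<k)))))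
                          (QP.*-zeroʳ (c 0)))
                   (convolve-vanishes m (c ∘ suc) d n (λ i m<i → c-vanishes (suc i) (s≤s m<i)) d-vanishes k m+n<k))
        (QP.+-identityˡ _)

degree-* : ∀ p q {m n} → HasDegree p m → HasDegree q n → HasDegree (p *ₚ q) (m N.+ n)
degree-* p q {m} {n} (p[m]≢0 , p-vanishes) (q[n]≢0 , q-vanishes) = lead≢0 , vanishes
  where
  lead≡ : coeff (p *ₚ q) (m N.+ n) ≡ coeff p m * coeff q n
  lead≡ = trans (coeff-* p q (m N.+ n)) (convolve-top m (coeff p) (coeff q) n p-vanishes q-vanishes)
  lead≢0 : coeff (p *ₚ q) (m N.+ n) ≢ 0ℚ
  lead≢0 lead≡0 = [ p[m]≢0 , q[n]≢0 ]′ (zero-divisor _ _ (trans (sym lead≡) lead≡0))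
  vanishes : VanishesBeyond (coeff (p *ₚ q)) (m N.+ n)
  vanishes i lt = trans (coeff-* p q i) (convolve-vanishes m (coeff p) (coeff q) n p-vanishes q-vanishes i lt)

1ₚ-degree : HasDegree 1ₚ 0
1ₚ-degree = QP.1≢0 , λ { (suc i) _ → refl }

constant-unit : ∀ p → HasDegree p 0 → IsUnit p
constant-unit p (p₀≢0 , p-vanishes) = p⁻¹ , p*p⁻¹≈1
  where
  instance
    p₀-nonZero : Q.NonZero (coeff p 0)
    p₀-nonZero = Q.≢-nonZero p₀≢0
  p⁻¹ : Poly
  p⁻¹ = (1/ coeff p 0) ∷ []
  p*p⁻¹≈1 : p *ₚ p⁻¹ ≈ₚ 1ₚ
  p*p⁻¹≈1 zero    = trans (coeff-* p p⁻¹ 0) (QP.*-inverseʳ (coeff p 0))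
  p*p⁻¹≈1 (suc k) = trans (coeff-* p p⁻¹ (suc k))
    (convolve-vanishes 0 (coeff p) (coeff p⁻¹) 0 p-vanishes (λ { (suc i) _ → refl }) (suc k) (s≤s z≤n))

eval : Poly → ℚ → ℚ
eval []      r = 0ℚ
eval (a ∷ p) r = a + r * eval p r

eval-+ : ∀ p q r → eval (p +ₚ q) r ≡ eval p r + eval q r
eval-+ []      q       r = sym (QP.+-identityˡ _)
eval-+ (a ∷ p) []      r = sym (QP.+-identityʳ _)
eval-+ (a ∷ p) (b ∷ q) r =
  trans (cong (λ x → (a + b) + r * x) (eval-+ p q r)) (regroup a b (eval p r) (eval q r) r)
  where
  regroup : ∀ a b x y r → (a + b) + r * (x + y) ≡ (a + r * x) + (b + r * y)
  regroup = solve-∀ ℚ-ring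

eval-scale : ∀ a q r → eval (map (a *_) q) r ≡ a * eval q r
eval-scale a []      r = sym (QP.*-zeroʳ a)
eval-scale a (b ∷ q) r =
  trans (cong (λ x → a * b + r * x) (eval-scale a q r)) (factor a b (eval q r) r)
  where
  factor : ∀ a b x r → a * b + r * (a * x) ≡ a * (b + r * x)
  factor = solve-∀ ℚ-ring

eval-* : ∀ p q r → eval (p *ₚ q) r ≡ eval p r * eval q r
eval-* []      q r = sym (QP.*-zeroˡ (eval q r))
eval-* (a ∷ p) q r = begin
  eval (map (a *_) q +ₚ (0ℚ ∷ (p *ₚ q))) r      ≡⟨ eval-+ (map (a *_) q) (0ℚ ∷ (p *ₚ q)) r ⟩
  eval (map (a *_) q) r + (0ℚ + r * eval (p *ₚ q) r)
    ≡⟨ cong₂ (λ x y → x + (0ℚ + r * y)) (eval-scale a q r) (eval-* p q r) ⟩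
  a * eval q r + (0ℚ + r * (eval p r * eval q r)) ≡⟨ horner a (eval p r) (eval q r) r ⟩
  (a + r * eval p r) * eval q r                   ∎
  where
  open ≡-Reasoning
  horner : ∀ a x y r → a * y + (0ℚ + r * (x * y)) ≡ (a + r * x) * y
  horner = solve-∀ ℚ-ring

eval-zero : ∀ p r → p ≈ₚ 0ₚ → eval p r ≡ 0ℚ
eval-zero []      r p≈0 = refl
eval-zero (a ∷ p) r p≈0 = begin
  a + r * eval p r ≡⟨ cong₂ (λ x y → x + r * y) (p≈0 0) (eval-zero p r (p≈0 ∘ suc)) ⟩
  0ℚ + r * 0ℚ      ≡⟨ cong (λ x → 0ℚ + x) (QP.*-zeroʳ r) ⟩
  0ℚ + 0ℚ          ≡⟨ QP.+-identityˡ 0ℚ ⟩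
  0ℚ               ∎
  where open ≡-Reasoning

eval-cong : ∀ p q r → p ≈ₚ q → eval p r ≡ eval q r
eval-cong []      q       r p≈q = sym (eval-zero q r (≈ₚ-sym [] q p≈q))
eval-cong (a ∷ p) []      r p≈q = eval-zero (a ∷ p) r p≈q
eval-cong (a ∷ p) (b ∷ q) r p≈q = cong₂ (λ x y → x + r * y) (p≈q 0) (eval-cong p q r (p≈q ∘ suc))

truncation : (ℕ → ℚ) → ℕ → Poly
truncation c zero    = c 0 ∷ []
truncation c (suc n) = c 0 ∷ truncation (c ∘ suc) n

truncation-coeff : ∀ c n → VanishesBeyond c n → ∀ i → coeff (truncation c n) i ≡ c i
truncation-coeff c zero    c-vanishes zero    = refl
truncation-coeff c zero    c-vanishes (suc i) = sym (c-vanishes (suc i) (s≤s z≤n))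
truncation-coeff c (suc n) c-vanishes zero    = refl
truncation-coeff c (suc n) c-vanishes (suc i) =
  truncation-coeff (c ∘ suc) n (λ j n<j → c-vanishes (suc j) (s≤s n<j)) i

truncate : ∀ p n → VanishesBeyond (coeff p) n → p ≈ₚ truncation (coeff p) n
truncate p n p-vanishes i = sym (truncation-coeff (coeff p) n p-vanishes i)

-- a₀ + a₁x has the root −a₀/a₁
root-identity : ∀ a₀ a₁ i → a₀ + (- (a₀ * i)) * (a₁ + (- (a₀ * i)) * 0ℚ) ≡ a₀ * (1ℚ - i * a₁)
root-identity = solve-∀ ℚ-ring

linear-root : ∀ p → HasDegree p 1 → ∃ λ r → eval p r ≡ 0ℚ
linear-root p (p₁≢0 , p-vanishes) = r , (begin
  eval p r                                 ≡⟨ eval-cong p (truncation (coeff p) 1) r (truncate p 1 p-vanishes) ⟩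
  p₀ + r * (p₁ + r * 0ℚ)                   ≡⟨ root-identity p₀ p₁ (1/ p₁) ⟩
  p₀ * (1ℚ - (1/ p₁) * p₁)                 ≡⟨ cong (λ x → p₀ * (1ℚ - x)) (QP.*-inverseˡ p₁) ⟩
  p₀ * (1ℚ - 1ℚ)                           ≡⟨ cong (p₀ *_) (QP.+-inverseʳ 1ℚ) ⟩
  p₀ * 0ℚ                                  ≡⟨ QP.*-zeroʳ p₀ ⟩
  0ℚ                                       ∎)
  where
  open ≡-Reasoning
  p₀ p₁ r : ℚ
  p₀ = coeff p 0
  p₁ = coeff p 1
  instance
    p₁-nonZero : Q.NonZero p₁
    p₁-nonZero = Q.≢-nonZero p₁≢0
  r = - (p₀ * 1/ p₁)

root-of-factor : ∀ p g h r → p ≈ₚ g *ₚ h → eval g r ≡ 0ℚ ⊎ eval h r ≡ 0ℚ → eval p r ≡ 0ℚ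
root-of-factor p g h r p≈gh root = begin
  eval p r            ≡⟨ eval-cong p (g *ₚ h) r p≈gh ⟩
  eval (g *ₚ h) r     ≡⟨ eval-* g h r ⟩
  eval g r * eval h r ≡⟨ [ left-zero , right-zero ]′ root ⟩
  0ℚ                  ∎
  where
  open ≡-Reasoning
  left-zero : eval g r ≡ 0ℚ → eval g r * eval h r ≡ 0ℚ
  left-zero g[r]≡0 = trans (cong (_* eval h r) g[r]≡0) (QP.*-zeroˡ (eval h r))
  right-zero : eval h r ≡ 0ℚ → eval g r * eval h r ≡ 0ℚ
  right-zero h[r]≡0 = trans (cong (eval g r *_) h[r]≡0) (QP.*-zeroʳ (eval g r))

linear-factor-root : ∀ p g h → p ≈ₚ g *ₚ h → HasDegree g 1 ⊎ HasDegree h 1 → ∃ λ r → eval p r ≡ 0ℚ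
linear-factor-root p g h p≈gh (inj₁ g-linear) =
  let (r , g[r]≡0) = linear-root g g-linear in r , root-of-factor p g h r p≈gh (inj₁ g[r]≡0)
linear-factor-root p g h p≈gh (inj₂ h-linear) =
  let (r , h[r]≡0) = linear-root h h-linear in r , root-of-factor p g h r p≈gh (inj₂ h[r]≡0)

-- If (p/q)² = D with p/q in lowest terms, then q ∣ p², so q ∣ p and q = 1.
rational-sqrt-integral : ∀ w D → w * w ≡ ℤ→ℚ D → ∃ λ n → n Z.* n ≡ D
rational-sqrt-integral w@(mkℚ p q-1 p⊥q) D w²≡D = p , p²≡D
  where
  q : ℕ
  q = suc q-1
  coprime : Coprime Z.∣ p ∣ q
  coprime = Coprimality.recompute p⊥q
  w²≃D : Q.toℚᵘ w U.* Q.toℚᵘ w U.≃ U.mkℚᵘ D 0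
  w²≃D = UP.≃-trans (UP.≃-sym (QP.toℚᵘ-homo-* w w))
           (subst (λ z → Q.toℚᵘ (w * w) U.≃ Q.toℚᵘ z) (trans w²≡D (ℤ→ℚ≡fromℤ D)) UP.≃-refl)
  cross : (p Z.* p) Z.* + 1 ≡ D Z.* + (q N.* q)
  cross with w²≃D
  ... | U.*≡* eq = eq
  cross-abs : Z.∣ p ∣ N.* Z.∣ p ∣ ≡ Z.∣ D ∣ N.* (q N.* q)
  cross-abs = trans (sym (ZP.abs-* p p))
                (trans (cong Z.∣_∣ (sym (ZP.*-identityʳ (p Z.* p))))
                  (trans (cong Z.∣_∣ cross) (ZP.abs-* D (+ (q N.* q)))))
  q∣p : q ∣ₙ Z.∣ p ∣
  q∣p = Coprimality.coprime-divisor (Coprimality.sym coprime)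
          (divides (Z.∣ D ∣ N.* q) (trans cross-abs (sym (NP.*-assoc Z.∣ D ∣ q q))))
  q≡1 : q ≡ 1
  q≡1 = coprime (q∣p , ∣-refl)
  p²≡D : p Z.* p ≡ D
  p²≡D = trans (sym (ZP.*-identityʳ (p Z.* p)))
           (trans cross (trans (cong (λ k → D Z.* + (k N.* k)) q≡1) (ZP.*-identityʳ D)))

square-abs : ∀ n → n Z.* n ≡ + (Z.∣ n ∣ N.* Z.∣ n ∣)
square-abs (+ k)    = sym (ZP.pos-* k k)
square-abs -[1+ k ] = refl

square-reflects-< : ∀ a b → a N.* a N.< b N.* b → a N.< b
square-reflects-< a b a²<b² with a N.<? b
... | yes a<b = a<b
... | no  a≮b = contradiction (NP.*-mono-≤ (NP.≮⇒≥ a≮b) (NP.≮⇒≥ a≮b)) (NP.<⇒≱ a²<b²)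

between-squares : ∀ r N → r N.* r N.< N → N N.< suc r N.* suc r → ∀ k → k N.* k ≢ N
between-squares r N lower upper k refl =
  NP.<⇒≱ (square-reflects-< r k lower) (NP.≤-pred (square-reflects-< k (suc r) upper))

square≡1-2square : ∀ m n → n Z.* n ≡ + 1 Z.- + 2 Z.* (m Z.* m) → m ≡ + 0
square≡1-2square m n n²≡1-2m² = ZP.∣i∣≡0⇒i≡0 (abs-m≡0 Z.∣ m ∣ (ZP.+-injective sum≡1))
  where
  rearrange : ∀ m n → n Z.* n ≡ + 1 Z.- + 2 Z.* (m Z.* m) → n Z.* n Z.+ + 2 Z.* (m Z.* m) ≡ + 1
  rearrange m n e = trans (cong (Z._+ + 2 Z.* (m Z.* m)) e) (cancel m)
    where
    cancel : ∀ m → + 1 Z.- + 2 Z.* (m Z.* m) Z.+ + 2 Z.* (m Z.* m) ≡ + 1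
    cancel = ZSolver.solve-∀
  sum≡1 : + (Z.∣ n ∣ N.* Z.∣ n ∣ N.+ 2 N.* (Z.∣ m ∣ N.* Z.∣ m ∣)) ≡ + 1
  sum≡1 = trans (cong₂ Z._+_ (sym (square-abs n))
                   (trans (ZP.pos-* 2 (Z.∣ m ∣ N.* Z.∣ m ∣)) (cong (+ 2 Z.*_) (sym (square-abs m)))))
                (rearrange m n n²≡1-2m²)
  abs-m≡0 : ∀ j → Z.∣ n ∣ N.* Z.∣ n ∣ N.+ 2 N.* (j N.* j) ≡ 1 → j ≡ 0
  abs-m≡0 zero    _   = refl
  abs-m≡0 (suc j) sum = contradiction
    (NP.≤-trans (NP.*-monoʳ-≤ 2 (s≤s (z≤n {j N.+ j N.* suc j}))) (NP.≤-trans (NP.m≤n+m _ _) (NP.≤-reflexive sum)))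
    λ { (s≤s ()) }

-- D(t) = (t+1)⁴ − 8t = t⁴ + 4t³ + 6t² − 4t + 1, which a quadratic factor of f₁
-- would make a square
Dℤ : ℤ → ℤ
Dℤ t = ((t Z.+ + 1) Z.* (t Z.+ + 1)) Z.* ((t Z.+ + 1) Z.* (t Z.+ + 1)) Z.- + 8 Z.* t

-- for T ≥ 2: (T²+2T)² < D(T) < (T²+2T+1)², as 0 < 8T < 2(T²+2T) + 1
D-pos-not-square : ∀ j k → let T = 2 N.+ j in
                   k N.* k N.+ 8 N.* T ≢ ((T N.+ 1) N.* (T N.+ 1)) N.* ((T N.+ 1) N.* (T N.+ 1))
D-pos-not-square j k e = between-squares r (k N.* k) lower upper k refl
  where
  T r : ℕ
  T = 2 N.+ j
  r = T N.* T N.+ 2 N.* T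
  e′ : k N.* k N.+ 8 N.* T ≡ r N.* r N.+ (8 N.* T N.+ suc (4 N.* j N.+ 2 N.* (j N.* j)))
  e′ = trans e (identity j)
    where
    identity : ∀ j → let T = 2 N.+ j in let r = T N.* T N.+ 2 N.* T in
               ((T N.+ 1) N.* (T N.+ 1)) N.* ((T N.+ 1) N.* (T N.+ 1))
               ≡ r N.* r N.+ (8 N.* T N.+ suc (4 N.* j N.+ 2 N.* (j N.* j)))
    identity = NSolver.solve-∀
  lower : r N.* r N.< k N.* k
  lower = NP.+-cancelʳ-< (8 N.* T) (r N.* r) (k N.* k)
    (subst (r N.* r N.+ 8 N.* T N.<_) (sym e′)
      (NP.+-monoʳ-< (r N.* r) (NP.m<m+n (8 N.* T) (s≤s z≤n))))
  upper : k N.* k N.< suc r N.* suc r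
  upper = subst (k N.* k N.<_) (trans e (cong (λ x → x N.* x) (square-succ T)))
            (NP.m<m+n (k N.* k) (s≤s z≤n))
    where
    square-succ : ∀ T → (T N.+ 1) N.* (T N.+ 1) ≡ suc (T N.* T N.+ 2 N.* T)
    square-succ = NSolver.solve-∀

-- for K ≥ 5: (K²)² < D(−1−K) = K⁴ + 8K + 8 < (K²+1)²; smaller K are checked directly
D-neg-not-square : ∀ K k → k N.* k ≢ K N.* K N.* (K N.* K) N.+ (8 N.* K N.+ 8)
D-neg-not-square 0 = between-squares 2 8 (NP.<ᵇ⇒< 4 8 tt) (NP.<ᵇ⇒< 8 9 tt)
D-neg-not-square 1 = between-squares 4 17 (NP.<ᵇ⇒< 16 17 tt) (NP.<ᵇ⇒< 17 25 tt)
D-neg-not-square 2 = between-squares 6 40 (NP.<ᵇ⇒< 36 40 tt) (NP.<ᵇ⇒< 40 49 tt)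
D-neg-not-square 3 = between-squares 10 113 (NP.<ᵇ⇒< 100 113 tt) (NP.<ᵇ⇒< 113 121 tt)
D-neg-not-square 4 = between-squares 17 296 (NP.<ᵇ⇒< 289 296 tt) (NP.<ᵇ⇒< 296 324 tt)
D-neg-not-square K@(suc (suc (suc (suc (suc j))))) =
  between-squares r (r N.* r N.+ (8 N.* K N.+ 8)) lower upper
  where
  r : ℕ
  r = K N.* K
  lower : r N.* r N.< r N.* r N.+ (8 N.* K N.+ 8)
  lower = NP.m<m+n (r N.* r) (s≤s z≤n)
  upper : r N.* r N.+ (8 N.* K N.+ 8) N.< suc r N.* suc r
  upper = subst (r N.* r N.+ (8 N.* K N.+ 8) N.<_) (sym (identity j))
            (NP.+-monoʳ-< (r N.* r) (NP.m<m+n (8 N.* K N.+ 8) (s≤s z≤n)))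
    where
    identity : ∀ j → let K = 5 N.+ j in
               suc (K N.* K) N.* suc (K N.* K) ≡ K N.* K N.* (K N.* K) N.+ ((8 N.* K N.+ 8) N.+ suc (2 N.+ 12 N.* j N.+ 2 N.* (j N.* j)))
    identity = NSolver.solve-∀

D-not-square : ∀ t n → t ≢ + 0 → t ≢ + 1 → n Z.* n ≢ Dℤ t
D-not-square (+ 0)           n t≢0 t≢1 n²≡D = t≢0 refl
D-not-square (+ 1)           n t≢0 t≢1 n²≡D = t≢1 refl
D-not-square (+ suc (suc j)) n t≢0 t≢1 n²≡D = D-pos-not-square j (Z.∣ n ∣) (ZP.+-injective (begin
  + (k N.* k N.+ 8 N.* T)        ≡⟨ cong₂ Z._+_ (sym (square-abs n)) (ZP.pos-* 8 T) ⟩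
  n Z.* n Z.+ + 8 Z.* + T        ≡⟨ cong (Z._+ + 8 Z.* + T) n²≡D ⟩
  Dℤ (+ T) Z.+ + 8 Z.* + T       ≡⟨ identity (+ T) ⟩
  (+ S Z.* + S) Z.* (+ S Z.* + S) ≡⟨ cong (λ x → x Z.* x) (sym (ZP.pos-* S S)) ⟩
  + (S N.* S) Z.* + (S N.* S)     ≡⟨ sym (ZP.pos-* (S N.* S) (S N.* S)) ⟩
  + ((S N.* S) N.* (S N.* S))     ∎))
  where
  open ≡-Reasoning
  k T S : ℕ
  k = Z.∣ n ∣
  T = 2 N.+ j
  S = T N.+ 1
  identity : ∀ t → ((t Z.+ + 1) Z.* (t Z.+ + 1)) Z.* ((t Z.+ + 1) Z.* (t Z.+ + 1)) Z.- + 8 Z.* t Z.+ + 8 Z.* t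
                   ≡ ((t Z.+ + 1) Z.* (t Z.+ + 1)) Z.* ((t Z.+ + 1) Z.* (t Z.+ + 1))
  identity = ZSolver.solve-∀
D-not-square -[1+ K ]        n t≢0 t≢1 n²≡D = D-neg-not-square K (Z.∣ n ∣) (ZP.+-injective (begin
  + (Z.∣ n ∣ N.* Z.∣ n ∣)                      ≡⟨ sym (square-abs n) ⟩
  n Z.* n                                      ≡⟨ n²≡D ⟩
  Dℤ -[1+ K ]                                  ≡⟨ identity (+ K) ⟩
  (+ K Z.* + K) Z.* (+ K Z.* + K) Z.+ (+ 8 Z.* + K Z.+ + 8)
    ≡⟨ cong₂ Z._+_ (trans (cong (λ x → x Z.* x) (sym (ZP.pos-* K K))) (sym (ZP.pos-* (K N.* K) (K N.* K))))
                   (cong (Z._+ + 8) (sym (ZP.pos-* 8 K))) ⟩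
  + (K N.* K N.* (K N.* K) N.+ (8 N.* K N.+ 8)) ∎))
  where
  open ≡-Reasoning
  identity : ∀ x → let t = Z.- (+ 1 Z.+ x) in
             ((t Z.+ + 1) Z.* (t Z.+ + 1)) Z.* ((t Z.+ + 1) Z.* (t Z.+ + 1)) Z.- + 8 Z.* t
             ≡ (x Z.* x) Z.* (x Z.* x) Z.+ (+ 8 Z.* x Z.+ + 8)
  identity = ZSolver.solve-∀

ℤ→ℚ-quadratic : ∀ a b c t → let T = ℤ→ℚ t in
  ℤ→ℚ (+ a Z.* t Z.* t Z.- + b Z.* t Z.+ + c) ≡ κ a * T * T - κ b * T + κ c
ℤ→ℚ-quadratic a b c t =
  trans (ℤ→ℚ-+ (+ a Z.* t Z.* t Z.- + b Z.* t) (+ c)) (cong (_+ κ c) (trans (ℤ→ℚ-- (+ a Z.* t Z.* t) (+ b Z.* t)) (cong₂ _-_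
    (trans (ℤ→ℚ-* (+ a Z.* t) t) (cong (_* ℤ→ℚ t) (ℤ→ℚ-* (+ a) t)))
    (ℤ→ℚ-* (+ b) t))))

ℤ→ℚ-1-2square : ∀ m → ℤ→ℚ (+ 1 Z.- + 2 Z.* (m Z.* m)) ≡ κ 1 - κ 2 * (ℤ→ℚ m * ℤ→ℚ m)
ℤ→ℚ-1-2square m =
  trans (ℤ→ℚ-- (+ 1) (+ 2 Z.* (m Z.* m))) (cong (λ x → κ 1 - x) (trans (ℤ→ℚ-* (+ 2) (m Z.* m)) (cong (κ 2 *_) (ℤ→ℚ-* m m))))

ℤ→ℚ-D : ∀ t → let T = ℤ→ℚ t in
  ℤ→ℚ (Dℤ t) ≡ ((T + κ 1) * (T + κ 1)) * ((T + κ 1) * (T + κ 1)) - κ 8 * T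
ℤ→ℚ-D t = trans (ℤ→ℚ-- ((s Z.* s) Z.* (s Z.* s)) (+ 8 Z.* t)) (cong₂ _-_
  (trans (ℤ→ℚ-* (s Z.* s) (s Z.* s)) (cong (λ x → x * x) (trans (ℤ→ℚ-* s s) (cong (λ x → x * x) (ℤ→ℚ-+ t (+ 1))))))
  (ℤ→ℚ-* (+ 8) t))
  where
  s : ℤ
  s = t Z.+ + 1

f₁-degree : ∀ t → HasDegree (f₁ t) 4
f₁-degree t = QP.1≢0 , λ { _ (s≤s (s≤s (s≤s (s≤s (s≤s _))))) → refl }

f₁ℚ : ℚ → Poly
f₁ℚ T = (κ 6 * T * T - κ 4 * T + κ 1) ∷ (κ 4 * T * T - κ 4 * T + κ 2) ∷ (κ 2 * T * T + κ 2)
      ∷ κ 2 ∷ κ 1 ∷ []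

f₁≈f₁ℚ : ∀ t → f₁ t ≈ₚ f₁ℚ (ℤ→ℚ t)
f₁≈f₁ℚ t zero          = ℤ→ℚ-quadratic 6 4 1 t
f₁≈f₁ℚ t (suc zero)    = ℤ→ℚ-quadratic 4 4 2 t
f₁≈f₁ℚ t (suc (suc zero)) =
  trans (ℤ→ℚ-+ (+ 2 Z.* t Z.* t) (+ 2)) (cong (_+ κ 2) (trans (ℤ→ℚ-* (+ 2 Z.* t) t) (cong (_* ℤ→ℚ t) (ℤ→ℚ-* (+ 2) t))))
f₁≈f₁ℚ t (suc (suc (suc n))) = refl

-- (1) f₁(r) = ((r+1)r)² + (r+1−2T)² + 2(T(r+1))², which vanishes only if T = 0
f₁ℚ-no-root : ∀ T r → T ≢ 0ℚ → eval (f₁ℚ T) r ≢ 0ℚ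
f₁ℚ-no-root T r T≢0 f[r]≡0 = T≢0 (square-zero T (proj₁ (nonneg-sum-zero T²≥0 T²≥0 2T²≡0)))
  where
  open ≡-Reasoning
  A B C : ℚ
  A = (r + κ 1) * r
  B = r + κ 1 - κ 2 * T
  C = T * (r + κ 1)
  sum-of-squares : ∀ T r →
    (κ 6 * T * T - κ 4 * T + κ 1) + r * ((κ 4 * T * T - κ 4 * T + κ 2) + r * ((κ 2 * T * T + κ 2)
      + r * (κ 2 + r * (κ 1 + r * 0ℚ))))
    ≡ ((r + κ 1) * r) * ((r + κ 1) * r)
      + ((r + κ 1 - κ 2 * T) * (r + κ 1 - κ 2 * T) + ((T * (r + κ 1)) * (T * (r + κ 1)) + (T * (r + κ 1)) * (T * (r + κ 1))))
  sum-of-squares = solve-∀ ℚ-ring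
  T²≥0 : 0ℚ Q.≤ T * T
  T²≥0 = square-nonneg T
  2C²≥0 : 0ℚ Q.≤ C * C + C * C
  2C²≥0 = nonneg-+ (square-nonneg C) (square-nonneg C)
  B²+2C²≡0 : B * B + (C * C + C * C) ≡ 0ℚ
  B²+2C²≡0 = proj₂ (nonneg-sum-zero (square-nonneg A) (nonneg-+ (square-nonneg B) 2C²≥0)
                                    (trans (sym (sum-of-squares T r)) f[r]≡0))
  B≡0 : B ≡ 0ℚ
  B≡0 = square-zero B (proj₁ (nonneg-sum-zero (square-nonneg B) 2C²≥0 B²+2C²≡0))
  C≡0 : C ≡ 0ℚ
  C≡0 = square-zero C (proj₁ (nonneg-sum-zero (square-nonneg C) (square-nonneg C)
          (proj₂ (nonneg-sum-zero (square-nonneg B) 2C²≥0 B²+2C²≡0))))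
  2T²≡0 : T * T + T * T ≡ 0ℚ
  2T²≡0 = begin
    T * T + T * T ≡⟨ twice-square T r ⟩
    C - T * B     ≡⟨ cong₂ (λ x y → x - T * y) C≡0 B≡0 ⟩
    0ℚ - T * 0ℚ   ≡⟨ zero-minus-zero T ⟩
    0ℚ            ∎
    where
    twice-square : ∀ T r → T * T + T * T ≡ T * (r + κ 1) - T * (r + κ 1 - κ 2 * T)
    twice-square = solve-∀ ℚ-ring
    zero-minus-zero : ∀ T → 0ℚ - T * 0ℚ ≡ 0ℚ
    zero-minus-zero = solve-∀ ℚ-ring

-- a splitting x⁴ + e₃x³ + e₂x² + e₁x + e₀ = (x² + ax + b)(x² + cx + d)
record QuadraticSplitting (e₀ e₁ e₂ e₃ : ℚ) : Set where
  field
    a b c d  : ℚ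
    x³-coeff : a + c ≡ e₃
    x²-coeff : b + d + a * c ≡ e₂
    x¹-coeff : a * d + b * c ≡ e₁
    x⁰-coeff : b * d ≡ e₀

-- a monic quartic that is a product of two quadratics splits into monic
-- quadratics: divide the factors by their leading coefficients x₂, y₂ = 1/x₂
quadratic-splitting : ∀ e₀ e₁ e₂ e₃ x₀ x₁ x₂ y₀ y₁ y₂ →
  (e₀ ∷ e₁ ∷ e₂ ∷ e₃ ∷ 1ℚ ∷ []) ≈ₚ (x₀ ∷ x₁ ∷ x₂ ∷ []) *ₚ (y₀ ∷ y₁ ∷ y₂ ∷ []) →
  QuadraticSplitting e₀ e₁ e₂ e₃
quadratic-splitting e₀ e₁ e₂ e₃ x₀ x₁ x₂ y₀ y₁ y₂ e≈xy = record
  { a = x₁ * y₂ ; b = x₀ * y₂ ; c = y₁ * x₂ ; d = y₀ * x₂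
  ; x³-coeff = trans (x³-identity x₁ x₂ y₁ y₂) (sym (e≈xy 3))
  ; x²-coeff = trans (x²-identity x₀ x₁ x₂ y₀ y₁ y₂) (trans (drop x₂y₂-1≡0) (sym (e≈xy 2)))
  ; x¹-coeff = trans (x¹-identity x₀ x₁ x₂ y₀ y₁ y₂) (trans (drop x₂y₂-1≡0) (sym (e≈xy 1)))
  ; x⁰-coeff = trans (x⁰-identity x₀ x₂ y₀ y₂) (trans (drop x₂y₂-1≡0) (sym (e≈xy 0)))
  }
  where
  x₂y₂-1≡0 : x₂ * y₂ - 1ℚ ≡ 0ℚ
  x₂y₂-1≡0 = trans (cong (_- 1ℚ) (sym (e≈xy 4))) (QP.+-inverseʳ 1ℚ)
  drop : ∀ {a e z} → z ≡ 0ℚ → a + z * e ≡ a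
  drop {a} {e} refl = trans (cong (λ x → a + x) (QP.*-zeroˡ e)) (QP.+-identityʳ a)
  x³-identity : ∀ x₁ x₂ y₁ y₂ → x₁ * y₂ + y₁ * x₂ ≡ x₁ * y₂ + x₂ * y₁
  x³-identity = solve-∀ ℚ-ring
  x²-identity : ∀ x₀ x₁ x₂ y₀ y₁ y₂ → x₀ * y₂ + y₀ * x₂ + (x₁ * y₂) * (y₁ * x₂)
    ≡ (x₀ * y₂ + (x₁ * y₁ + (x₂ * y₀ + 0ℚ))) + (x₂ * y₂ - 1ℚ) * (x₁ * y₁)
  x²-identity = solve-∀ ℚ-ring
  x¹-identity : ∀ x₀ x₁ x₂ y₀ y₁ y₂ → (x₁ * y₂) * (y₀ * x₂) + (x₀ * y₂) * (y₁ * x₂)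
    ≡ (x₀ * y₁ + (x₁ * y₀ + 0ℚ)) + (x₂ * y₂ - 1ℚ) * (x₀ * y₁ + x₁ * y₀)
  x¹-identity = solve-∀ ℚ-ring
  x⁰-identity : ∀ x₀ x₂ y₀ y₂ → (x₀ * y₂) * (y₀ * x₂) ≡ (x₀ * y₀ + 0ℚ) + (x₂ * y₂ - 1ℚ) * (x₀ * y₀)
  x⁰-identity = solve-∀ ℚ-ring

-- (2a) eliminating b, c, d from a splitting of f₁ℚ T: s = a − 1 makes u = s² a
-- root of (u + B)·(u² + (2T²+4T)u − B), where B = 2T² − 4T + 1
splitting-resolvent : ∀ T →
  QuadraticSplitting (κ 6 * T * T - κ 4 * T + κ 1) (κ 4 * T * T - κ 4 * T + κ 2) (κ 2 * T * T + κ 2) (κ 2) →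
  ∃ λ s → (s * s + (κ 2 * T * T - κ 4 * T + κ 1))
          * ((s * s) * (s * s) + (κ 2 * T * T + κ 4 * T) * (s * s) - (κ 2 * T * T - κ 4 * T + κ 1)) ≡ 0ℚ
splitting-resolvent T split = s , (begin
  (u + B) * (u * u + (κ 2 * T * T + κ 4 * T) * u - B)
    ≡⟨ resolvent-identity T u ⟩
  u * (X * X) - (P₁ - X) * (P₁ - X) - κ 4 * u * P₀
    ≡⟨ cong (λ x → u * (x * x) - (P₁ - x) * (P₁ - x) - κ 4 * u * P₀) (sym b+d≡X) ⟩
  u * ((b + d) * (b + d)) - (P₁ - (b + d)) * (P₁ - (b + d)) - κ 4 * u * P₀
    ≡⟨ cong₂ (λ y z → u * ((b + d) * (b + d)) - y * y - κ 4 * u * z) (sym s[d-b]≡P₁-X) (sym x⁰-coeff) ⟩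
  u * ((b + d) * (b + d)) - (s * (d - b)) * (s * (d - b)) - κ 4 * u * (b * d)
    ≡⟨ vanishing-identity s b d ⟩
  0ℚ ∎)
  where
  open QuadraticSplitting split
  open ≡-Reasoning
  P₀ P₁ P₂ B s u X : ℚ
  P₀ = κ 6 * T * T - κ 4 * T + κ 1
  P₁ = κ 4 * T * T - κ 4 * T + κ 2
  P₂ = κ 2 * T * T + κ 2
  B  = κ 2 * T * T - κ 4 * T + κ 1
  s  = a - κ 1
  u  = s * s
  X  = P₂ - κ 1 + u
  c≡2-a : c ≡ κ 2 - a
  c≡2-a = trans (cancel a c) (cong (_- a) x³-coeff)
    where
    cancel : ∀ a c → c ≡ (a + c) - a
    cancel = solve-∀ ℚ-ring
  b+d≡X : b + d ≡ X
  b+d≡X = trans (identity a b d) (cong (λ z → z - κ 1 + u) (subst (λ c → b + d + a * c ≡ P₂) c≡2-a x²-coeff))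
    where
    identity : ∀ a b d → b + d ≡ (b + d + a * (κ 2 - a)) - κ 1 + (a - κ 1) * (a - κ 1)
    identity = solve-∀ ℚ-ring
  s[d-b]≡P₁-X : s * (d - b) ≡ P₁ - (b + d)
  s[d-b]≡P₁-X = trans (identity a b d) (cong (_- (b + d)) (subst (λ c → a * d + b * c ≡ P₁) c≡2-a x¹-coeff))
    where
    identity : ∀ a b d → (a - κ 1) * (d - b) ≡ (a * d + b * (κ 2 - a)) - (b + d)
    identity = solve-∀ ℚ-ring
  -- s²(b + d)² − s²(d − b)² − 4s²bd = 0, rewritten in terms of T and u
  resolvent-identity : ∀ T u →
    (u + (κ 2 * T * T - κ 4 * T + κ 1)) * (u * u + (κ 2 * T * T + κ 4 * T) * u - (κ 2 * T * T - κ 4 * T + κ 1))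
    ≡ u * (((κ 2 * T * T + κ 2) - κ 1 + u) * ((κ 2 * T * T + κ 2) - κ 1 + u))
      - ((κ 4 * T * T - κ 4 * T + κ 2) - ((κ 2 * T * T + κ 2) - κ 1 + u))
        * ((κ 4 * T * T - κ 4 * T + κ 2) - ((κ 2 * T * T + κ 2) - κ 1 + u))
      - κ 4 * u * (κ 6 * T * T - κ 4 * T + κ 1)
  resolvent-identity = solve-∀ ℚ-ring
  vanishing-identity : ∀ s b d →
    (s * s) * ((b + d) * (b + d)) - (s * (d - b)) * (s * (d - b)) - κ 4 * (s * s) * (b * d) ≡ 0ℚ
  vanishing-identity = solve-∀ ℚ-ring

no-quadratic-splitting : ∀ t → t ≢ + 0 → t ≢ + 1 → let T = ℤ→ℚ t in
  ¬ QuadraticSplitting (κ 6 * T * T - κ 4 * T + κ 1) (κ 4 * T * T - κ 4 * T + κ 2) (κ 2 * T * T + κ 2) (κ 2)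
no-quadratic-splitting t t≢0 t≢1 split =
  [ first-factor , second-factor ]′ (zero-divisor (s * s + B) Q (proj₂ (splitting-resolvent T split)))
  where
  open ≡-Reasoning
  T s B Q : ℚ
  T = ℤ→ℚ t
  s = proj₁ (splitting-resolvent T split)
  B = κ 2 * T * T - κ 4 * T + κ 1
  Q = (s * s) * (s * s) + (κ 2 * T * T + κ 4 * T) * (s * s) - B
  -- u + B = 0: then s² = 1 − 2(t − 1)², forcing t = 1
  first-factor : s * s + B ≡ 0ℚ → ⊥
  first-factor u+B≡0 = t≢1 (trans (shift t) (cong (Z._+ + 1) t-1≡0))
    where
    s²≡ : s * s ≡ ℤ→ℚ (+ 1 Z.- + 2 Z.* ((t Z.- + 1) Z.* (t Z.- + 1)))
    s²≡ = begin
      s * s                                              ≡⟨ identity s T ⟩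
      (s * s + B) + (κ 1 - κ 2 * ((T - κ 1) * (T - κ 1))) ≡⟨ cong (_+ (κ 1 - κ 2 * ((T - κ 1) * (T - κ 1)))) u+B≡0 ⟩
      0ℚ + (κ 1 - κ 2 * ((T - κ 1) * (T - κ 1)))         ≡⟨ QP.+-identityˡ (κ 1 - κ 2 * ((T - κ 1) * (T - κ 1))) ⟩
      κ 1 - κ 2 * ((T - κ 1) * (T - κ 1))               ≡⟨ cong (λ x → κ 1 - κ 2 * (x * x)) (sym (ℤ→ℚ-- t (+ 1))) ⟩
      κ 1 - κ 2 * (ℤ→ℚ (t Z.- + 1) * ℤ→ℚ (t Z.- + 1))   ≡⟨ sym (ℤ→ℚ-1-2square (t Z.- + 1)) ⟩
      ℤ→ℚ (+ 1 Z.- + 2 Z.* ((t Z.- + 1) Z.* (t Z.- + 1))) ∎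
      where
      identity : ∀ s T → s * s ≡ (s * s + (κ 2 * T * T - κ 4 * T + κ 1)) + (κ 1 - κ 2 * ((T - κ 1) * (T - κ 1)))
      identity = solve-∀ ℚ-ring
    t-1≡0 : t Z.- + 1 ≡ + 0
    t-1≡0 = let (n , n²≡) = rational-sqrt-integral s _ s²≡ in square≡1-2square (t Z.- + 1) n n²≡
    shift : ∀ t → t ≡ t Z.- + 1 Z.+ + 1
    shift = ZSolver.solve-∀
  -- u² + (2T²+4T)u − B = 0: then D(t) = (u + T² + 2T)², impossible for t ∉ {0, 1}
  second-factor : Q ≡ 0ℚ → ⊥
  second-factor Q≡0 = let (n , n²≡D) = rational-sqrt-integral w (Dℤ t) w²≡D in D-not-square t n t≢0 t≢1 n²≡D
    where
    w Dℚ : ℚ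
    w  = s * s + T * T + κ 2 * T
    Dℚ = ((T + κ 1) * (T + κ 1)) * ((T + κ 1) * (T + κ 1)) - κ 8 * T
    w²≡D : w * w ≡ ℤ→ℚ (Dℤ t)
    w²≡D = begin
      w * w    ≡⟨ identity (s * s) T ⟩
      Q + Dℚ   ≡⟨ cong (_+ Dℚ) Q≡0 ⟩
      0ℚ + Dℚ  ≡⟨ QP.+-identityˡ Dℚ ⟩
      Dℚ       ≡⟨ sym (ℤ→ℚ-D t) ⟩
      ℤ→ℚ (Dℤ t) ∎
      where
      identity : ∀ u T → (u + T * T + κ 2 * T) * (u + T * T + κ 2 * T)
        ≡ (u * u + (κ 2 * T * T + κ 4 * T) * u - (κ 2 * T * T - κ 4 * T + κ 1))
          + (((T + κ 1) * (T + κ 1)) * ((T + κ 1) * (T + κ 1)) - κ 8 * T)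
      identity = solve-∀ ℚ-ring

f₁-nonzero : ∀ t → ¬ (f₁ t ≈ₚ 0ₚ)
f₁-nonzero t f≈0 = QP.1≢0 (f≈0 4)

-- a unit has degree 0, but f₁·q has degree 4 + deg q
f₁-not-unit : ∀ t → ¬ IsUnit (f₁ t)
f₁-not-unit t (q , fq≈1) = [ q-zero , q-nonzero ]′ (degree q)
  where
  q-zero : q ≈ₚ 0ₚ → ⊥
  q-zero q≈0 = QP.1≢0 (trans (sym (fq≈1 0)) (*ₚ-zeroʳ (f₁ t) q q≈0 0))
  q-nonzero : ∃ (HasDegree q) → ⊥
  q-nonzero (n , q-degree) = 4+n≢0 (degree-unique 1ₚ
    (degree-cong (f₁ t *ₚ q) 1ₚ fq≈1 (degree-* (f₁ t) q (f₁-degree t) q-degree)) 1ₚ-degree)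
    where
    4+n≢0 : 4 N.+ n ≢ 0
    4+n≢0 ()

f₁-no-linear-factor : ∀ t → t ≢ + 0 → ∀ g h → f₁ t ≈ₚ g *ₚ h → ¬ (HasDegree g 1 ⊎ HasDegree h 1)
f₁-no-linear-factor t t≢0 g h f≈gh linear =
  let (r , f[r]≡0) = linear-factor-root (f₁ t) g h f≈gh linear
  in f₁ℚ-no-root (ℤ→ℚ t) r (λ T≡0 → t≢0 (ℤ→ℚ-injective t (+ 0) T≡0))
       (trans (sym (eval-cong (f₁ t) (f₁ℚ (ℤ→ℚ t)) r (f₁≈f₁ℚ t))) f[r]≡0)

f₁-no-quadratic-factors : ∀ t → t ≢ + 0 → t ≢ + 1 → ∀ g h → f₁ t ≈ₚ g *ₚ h →
                          HasDegree g 2 → ¬ HasDegree h 2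
f₁-no-quadratic-factors t t≢0 t≢1 g h f≈gh (_ , g-vanishes) (_ , h-vanishes) =
  no-quadratic-splitting t t≢0 t≢1 (quadratic-splitting
    (κ 6 * T * T - κ 4 * T + κ 1) (κ 4 * T * T - κ 4 * T + κ 2) (κ 2 * T * T + κ 2) (κ 2)
    (coeff g 0) (coeff g 1) (coeff g 2) (coeff h 0) (coeff h 1) (coeff h 2)
    (≈ₚ-trans (f₁ℚ T) (f₁ t) (G *ₚ H) (≈ₚ-sym (f₁ t) (f₁ℚ T) (f₁≈f₁ℚ t))
      (≈ₚ-trans (f₁ t) (g *ₚ h) (G *ₚ H) f≈gh
        (*ₚ-cong g G h H (truncate g 2 g-vanishes) (truncate h 2 h-vanishes)))))
  where
  T : ℚ
  T = ℤ→ℚ t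
  G H : Poly
  G = truncation (coeff g) 2
  H = truncation (coeff h) 2

f₁-factors : ∀ t → t ≢ + 0 → t ≢ + 1 → ∀ g h → f₁ t ≈ₚ g *ₚ h → IsUnit g ⊎ IsUnit h
f₁-factors t t≢0 t≢1 g h f≈gh = [ g-zero , g-nonzero ]′ (degree g)
  where
  g-zero : g ≈ₚ 0ₚ → IsUnit g ⊎ IsUnit h
  g-zero g≈0 = ⊥-elim (f₁-nonzero t (≈ₚ-trans (f₁ t) (g *ₚ h) 0ₚ f≈gh (*ₚ-zeroˡ g h g≈0)))
  h-zero : h ≈ₚ 0ₚ → IsUnit g ⊎ IsUnit h
  h-zero h≈0 = ⊥-elim (f₁-nonzero t (≈ₚ-trans (f₁ t) (g *ₚ h) 0ₚ f≈gh (*ₚ-zeroʳ g h h≈0)))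
  degrees-add : ∀ {m n} → HasDegree g m → HasDegree h n → m N.+ n ≡ 4
  degrees-add g-deg h-deg = degree-unique (f₁ t)
    (degree-cong (g *ₚ h) (f₁ t) (≈ₚ-sym (f₁ t) (g *ₚ h) f≈gh) (degree-* g h g-deg h-deg)) (f₁-degree t)
  by-degrees : ∀ m n → m N.+ n ≡ 4 → HasDegree g m → HasDegree h n → IsUnit g ⊎ IsUnit h
  by-degrees 0 _ _    g-deg _     = inj₁ (constant-unit g g-deg)
  by-degrees 1 _ _    g-deg _     = ⊥-elim (f₁-no-linear-factor t t≢0 g h f≈gh (inj₁ g-deg))
  by-degrees 2 2 refl g-deg h-deg = ⊥-elim (f₁-no-quadratic-factors t t≢0 t≢1 g h f≈gh g-deg h-deg)
  by-degrees 3 1 refl _     h-deg = ⊥-elim (f₁-no-linear-factor t t≢0 g h f≈gh (inj₂ h-deg))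
  by-degrees 4 0 refl _     h-deg = inj₂ (constant-unit h h-deg)
  g-nonzero : ∃ (HasDegree g) → IsUnit g ⊎ IsUnit h
  g-nonzero (m , g-deg) =
    [ h-zero , (λ (n , h-deg) → by-degrees m n (degrees-add g-deg h-deg) g-deg h-deg) ]′ (degree h)

lemma2p1 : (t : ℤ) → t ≢ + 0 → t ≢ + 1 → Irreducible (f₁ t)
lemma2p1 t t≢0 t≢1 = f₁-nonzero t , f₁-not-unit t , f₁-factors t t≢0 t≢1
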